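{- Let $\mathcal{C}$ be a standard closure system over a finite set $U$ and let $(U_1,U_2)$ be a bipartition of $U$ into nonempty disjoint sets with $U_2\in\mathcal{C}$. Let $\mathcal{C}_1=\{C\cap U_1 : C\in\mathcal{C},\ U_2\subseteq C\}$, $\mathcal{C}_2=\{C\in\mathcal{C}: C\subseteq U_2\}$, and let $\mathcal{M}_2$ be the set of meet-irreducible elements of $\mathcal{C}_2$; for $C_2\in\mathcal{C}_2$ put $\mathcal{M}_2(C_2)=\{M\in\mathcal{M}_2: C_2\subseteq M\}$. Then $(U_1,U_2)$ is an acyclic split of $\mathcal{C}$ if and only if for every $C_2\in\mathcal{C}_2$ and every $C_2'\in\mathcal{M}_2(C_2)\cup\{U_2\}$, $\mathrm{Ext}(C_2):U_1\subseteq\mathrm{Ext}(C_2'):U_1$.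
   Context: A closure system over $U$ is a family $\mathcal{C}$ of subsets of $U$ with $U\in\mathcal{C}$ and closed under intersection; with closure operator $\phi(X)=\bigcap\{C\in\mathcal{C}: X\subseteq C\}$ it is standard if $\phi(\{u\})\setminus\{u\}\in\mathcal{C}$ for every $u\in U$. A meet-irreducible element of a closure system $\mathcal{F}$ over a set $V$ is a closed set $M\neq V$ such that $M=C\cap C'$ with $C,C'\in\mathcal{F}$ implies $M=C$ or $M=C'$. An implication over $U$ is written $A \to b$ with $A \subseteq U$ nonempty and $b \in U$; an implicational base is a finite set of implications; $\Sigma$ is an implicational base for $\mathcal{C}$ if $\mathcal{C}$ is exactly the family of $C\subseteq U$ such that $A\subseteq C$ implies $b\in C$ for all $A\to b\in\Sigma$. For $X\subseteq U$, $\Sigma[X]=\{A\to b\in\Sigma: A\cup\{b\}\subseteq X\}$, and $\Sigma[U_1,U_2]:=\Sigma\setminus(\Sigma[U_1]\cup\Sigma[U_2])$. $(U_1,U_2)$ is an acyclic split of $\mathcal{C}$ if there is an implicational base $\Sigma$ for $\mathcal{C}$ in which every premise is contained in $U_1$ or in $U_2$ and every $A\to b\in\Sigma[U_1,U_2]$ has $A\subseteq U_1$. For $C_2\in\mathcal{C}_2$, $\mathrm{Ext}(C_2)=\{C\in\mathcal{C}: C\cap U_2=C_2\}$ and $\mathrm{Ext}(C_2):U_1=\{C\cap U_1: C\in\mathrm{Ext}(C_2)\}$. -}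

module Defs where

open import Data.Nat using (ℕ; zero; suc)
open import Data.Bool using (true; false)
open import Data.Vec using ([]; _∷_)
open import Data.List using (List; []; _∷_; map; _++_; filter)
open import Data.List.Membership.Propositional using () renaming (_∈_ to _∈ₗ_)
open import Data.Fin using (Fin)
open import Data.Fin.Subset
open import Data.Fin.Subset.Properties using (_⊆?_)
open import Data.Product using (Σ; ∃; _×_; _,_)
open import Data.Sum using (_⊎_)
open import Relation.Nullary using (¬_)
open import Relation.Nullary.Decidable using (_×-dec_)
open import Relation.Unary using (Pred; Decidable)
open import Relation.Binary.PropositionalEquality using (_≡_; _≢_)
open import Level using (0ℓ)

Family : ℕ → Set₁
Family n = Pred (Subset n) 0ℓ

-- Closure system: U ∈ 𝒞 and closed under (binary, hence all finite) intersections.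
record IsClosureSystem {n : ℕ} (𝒞 : Family n) : Set where
  field
    top-closed : 𝒞 ⊤
    ∩-closed   : ∀ {C D} → 𝒞 C → 𝒞 D → 𝒞 (C ∩ D)

allSubsets : (n : ℕ) → List (Subset n)
allSubsets zero = [] ∷ []
allSubsets (suc n) = map (true ∷_) (allSubsets n) ++ map (false ∷_) (allSubsets n)

φ : {n : ℕ} (𝒞 : Family n) → Decidable 𝒞 → Subset n → Subset n
φ {n} 𝒞 𝒞? X = ⋂ (filter (λ C → 𝒞? C ×-dec (X ⊆? C)) (allSubsets n))

IsStandard : {n : ℕ} (𝒞 : Family n) → Decidable 𝒞 → Set
IsStandard {n} 𝒞 𝒞? = ∀ (u : Fin n) → 𝒞 (φ 𝒞 𝒞? ⁅ u ⁆ - u)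

record Implication (n : ℕ) : Set where
  constructor _⇒_∣_
  field
    premise    : Subset n
    conclusion : Fin n
    premise≠∅  : Nonempty premise
open Implication public

ImplicationalBase : ℕ → Set
ImplicationalBase n = List (Implication n)

Respects : {n : ℕ} → ImplicationalBase n → Subset n → Set
Respects Σ' C = ∀ {i} → i ∈ₗ Σ' → premise i ⊆ C → conclusion i ∈ C

IsBaseFor : {n : ℕ} → ImplicationalBase n → Family n → Set
IsBaseFor Σ' 𝒞 = ∀ C → (𝒞 C → Respects Σ' C) × (Respects Σ' C → 𝒞 C)

-- A ∪ {b} ⊆ X, i.e. membership of an implication of Σ in Σ[X].
InsideOf : {n : ℕ} → Implication n → Subset n → Set
InsideOf i X = (premise i ∪ ⁅ conclusion i ⁆) ⊆ X

InCross : {n : ℕ} → ImplicationalBase n → Subset n → Subset n → Implication n → Set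
InCross Σ' U₁ U₂ i = i ∈ₗ Σ' × ¬ InsideOf i U₁ × ¬ InsideOf i U₂

AcyclicSplit : {n : ℕ} → Family n → Subset n → Subset n → Set
AcyclicSplit 𝒞 U₁ U₂ =
  Σ (ImplicationalBase _) λ Σ' →
    IsBaseFor Σ' 𝒞
    × (∀ {i} → i ∈ₗ Σ' → premise i ⊆ U₁ ⊎ premise i ⊆ U₂)
    × (∀ i → InCross Σ' U₁ U₂ i → premise i ⊆ U₁)

𝒞₂ : {n : ℕ} → Family n → Subset n → Family n
𝒞₂ 𝒞 U₂ C = 𝒞 C × C ⊆ U₂

MeetIrreducible₂ : {n : ℕ} → Family n → Subset n → Subset n → Set
MeetIrreducible₂ 𝒞 U₂ M =
  𝒞₂ 𝒞 U₂ M × M ≢ U₂ ×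
  (∀ C C' → 𝒞₂ 𝒞 U₂ C → 𝒞₂ 𝒞 U₂ C' → M ≡ C ∩ C' → M ≡ C ⊎ M ≡ C')

InExtRestr : {n : ℕ} → Family n → Subset n → Subset n → Subset n → Subset n → Set
InExtRestr 𝒞 U₁ U₂ C₂ X = ∃ λ C → 𝒞 C × C ∩ U₂ ≡ C₂ × X ≡ C ∩ U₁

-- If every premise of a base lies in U₁ or in U₂, then for closed C and C₂ ⊆ C₂' in 𝒞₂ the set
-- (C ∩ U₁) ∪ C₂' is again closed, so Ext(C₂):U₁ ⊆ Ext(C₂'):U₁.  Conversely, take as base all
-- valid implications whose premise lies in U₁ or in U₂; premises in U₂ give no cross implications
-- because U₂ is closed.  Extensions with a fixed trace X on U₁ are closed under intersection, and
-- every member of 𝒞₂ is an intersection of meet-irreducibles and U₂, so the hypothesis makes Ext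
-- monotone on 𝒞₂.  For Y respecting the base, Y ∩ U₁ lies in Ext(φ(Y ∩ U₁) ∩ U₂):U₁, hence in
-- Ext(Y ∩ U₂):U₁, and the closed set witnessing this is Y.  Standardness enters only through ∅ ∈ 𝒞.

module Submission where

open import Defs
open import Data.Nat using (ℕ)
open import Data.Bool using (true; false)
open import Data.Bool.Properties using () renaming (_≟_ to _≟ᵇ_)
open import Data.Vec using ([]; _∷_; there)
open import Data.Vec.Properties using (≡-dec)
open import Data.Fin using (Fin)
open import Data.Fin.Properties using (any?)
open import Data.Fin.Subset
open import Data.Fin.Subset.Properties
open import Data.Fin.Subset.Induction using (Acc; acc; ⊃-wellFounded)
open import Data.List using (List; []; _∷_; map; filter; concatMap; cartesianProduct; allFin)
open import Data.List.Membership.Propositional using (lose) renaming (_∈_ to _∈ₗ_)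
open import Data.List.Membership.Propositional.Properties
  using (∈-map⁺; ∈-++⁺ˡ; ∈-++⁺ʳ; ∈-filter⁺; ∈-concatMap⁺; ∈-concatMap⁻; ∈-cartesianProduct⁺; ∈-allFin)
open import Data.List.Relation.Unary.All as All using (All; []; _∷_)
open import Data.List.Relation.Unary.All.Properties using (all-filter; map⁺)
open import Data.List.Relation.Unary.Any using (here; there; satisfied)
open import Data.Product using (∃; ∃₂; _×_; _,_; proj₁; proj₂; uncurry)
open import Data.Sum using (_⊎_; inj₁; inj₂)
open import Data.Empty using (⊥-elim)
open import Relation.Nullary using (Dec; yes; no; contradiction)
open import Relation.Nullary.Decidable using (_×-dec_; _⊎-dec_; ¬?)
open import Relation.Unary using (Pred; Decidable)
open import Relation.Binary.PropositionalEquality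
  using (_≡_; _≢_; refl; sym; subst; cong; cong₂; module ≡-Reasoning)
open import Algebra.Bundles using (CommutativeMonoid)
import Algebra.Properties.CommutativeSemigroup as CommutativeSemigroupProperties
open import Function.Bundles using (_⇔_; mk⇔)
open import Level using (0ℓ)

module _ {n : ℕ} where

  _≟ₛ_ : (p q : Subset n) → Dec (p ≡ q)
  _≟ₛ_ = ≡-dec _≟ᵇ_

  ⊆∧≢⇒⊂ : {p q : Subset n} → p ⊆ q → p ≢ q → p ⊂ q
  ⊆∧≢⇒⊂ {p} {q} p⊆q p≢q with any? (λ x → (x ∈? q) ×-dec ¬? (x ∈? p))
  ... | yes (x , x∈q , x∉p) = p⊆q , x , x∈q , x∉p
  ... | no ∄x = contradiction (⊆-antisym p⊆q q⊆p) p≢q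
    where
    q⊆p : q ⊆ p
    q⊆p {x} x∈q with x ∈? p
    ... | yes x∈p = x∈p
    ... | no x∉p = contradiction (x , x∈q , x∉p) ∄x

  ⊆⇒∩≡ : {p q : Subset n} → p ⊆ q → p ∩ q ≡ p
  ⊆⇒∩≡ {p} {q} p⊆q = ⊆-antisym (p∩q⊆p p q) (λ x∈p → x∈p∩q⁺ (x∈p , p⊆q x∈p))

  ∩-distribʳ-∩ : (r p q : Subset n) → (p ∩ q) ∩ r ≡ (p ∩ r) ∩ (q ∩ r)
  ∩-distribʳ-∩ r p q = begin
    (p ∩ q) ∩ r        ≡⟨ cong ((p ∩ q) ∩_) (sym (∩-idem r)) ⟩
    (p ∩ q) ∩ (r ∩ r)  ≡⟨ interchange p q r r ⟩
    (p ∩ r) ∩ (q ∩ r)  ∎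
    where
    open ≡-Reasoning
    open CommutativeSemigroupProperties
      (CommutativeMonoid.commutativeSemigroup (∩-commutativeMonoid n)) using (interchange)

  ⋂-lowerBound : {p : Subset n} {ps : List (Subset n)} → p ∈ₗ ps → ⋂ ps ⊆ p
  ⋂-lowerBound {ps = q ∷ ps} (here refl) = p∩q⊆p q (⋂ ps)
  ⋂-lowerBound {ps = q ∷ ps} (there p∈ps) x∈⋂ = ⋂-lowerBound p∈ps (p∩q⊆q q (⋂ ps) x∈⋂)

  ⋂-greatest : {q : Subset n} {ps : List (Subset n)} → All (q ⊆_) ps → q ⊆ ⋂ ps
  ⋂-greatest []           _   = ∈⊤
  ⋂-greatest (q⊆p ∷ q⊆ps) x∈q = x∈p∩q⁺ (q⊆p x∈q , ⋂-greatest q⊆ps x∈q)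

x∉p-x : {n : ℕ} (p : Subset n) (x : Fin n) → x ∉ p - x
x∉p-x (_ ∷ p) Fin.zero    ()
x∉p-x (_ ∷ p) (Fin.suc x) (there x∈p-x) = x∉p-x p x x∈p-x

∈-allSubsets : {n : ℕ} (p : Subset n) → p ∈ₗ allSubsets n
∈-allSubsets []                    = here refl
∈-allSubsets {ℕ.suc n} (true ∷ p)  = ∈-++⁺ˡ (∈-map⁺ (true ∷_) (∈-allSubsets p))
∈-allSubsets {ℕ.suc n} (false ∷ p) =
  ∈-++⁺ʳ (map (true ∷_) (allSubsets n)) (∈-map⁺ (false ∷_) (∈-allSubsets p))

module ClosureSystemProperties {n : ℕ} {𝒞 : Family n} (cs : IsClosureSystem 𝒞) (𝒞? : Decidable 𝒞) where
  open IsClosureSystem cs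

  ⋂-closed : {ps : List (Subset n)} → All 𝒞 ps → 𝒞 (⋂ ps)
  ⋂-closed []         = top-closed
  ⋂-closed (cp ∷ cps) = ∩-closed cp (⋂-closed cps)

  private
    closedSupersets? : (A : Subset n) → Decidable (λ C → 𝒞 C × A ⊆ C)
    closedSupersets? A C = 𝒞? C ×-dec (A ⊆? C)

    closedSupersets-all : (A : Subset n) →
      All (λ C → 𝒞 C × A ⊆ C) (filter (closedSupersets? A) (allSubsets n))
    closedSupersets-all A = all-filter (closedSupersets? A) (allSubsets n)

  φ-closed : (A : Subset n) → 𝒞 (φ 𝒞 𝒞? A)
  φ-closed A = ⋂-closed (All.map proj₁ (closedSupersets-all A))

  φ-extensive : {A : Subset n} → A ⊆ φ 𝒞 𝒞? A
  φ-extensive {A} = ⋂-greatest (All.map proj₂ (closedSupersets-all A))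

  φ-least : {A C : Subset n} → 𝒞 C → A ⊆ C → φ 𝒞 𝒞? A ⊆ C
  φ-least {A} {C} cC A⊆C =
    ⋂-lowerBound (∈-filter⁺ (closedSupersets? A) (∈-allSubsets C) (cC , A⊆C))

  φ⊆⇒closed : {A : Subset n} → φ 𝒞 𝒞? A ⊆ A → 𝒞 A
  φ⊆⇒closed {A} φA⊆A = subst 𝒞 (⊆-antisym φA⊆A φ-extensive) (φ-closed A)

  standard⇒⊥-closed : IsStandard 𝒞 𝒞? → 𝒞 ⊥
  standard⇒⊥-closed std =
    subst 𝒞 (Empty-unique nothing-in) (⋂-closed (map⁺ {xs = allFin n} (All.universal std _)))
    where
    punctured : Fin n → Subset n
    punctured u = φ 𝒞 𝒞? ⁅ u ⁆ - u
    nothing-in : Empty (⋂ (map punctured (allFin n)))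
    nothing-in (u , u∈⋂) =
      x∉p-x (φ 𝒞 𝒞? ⁅ u ⁆) u (⋂-lowerBound (∈-map⁺ punctured (∈-allFin u)) u∈⋂)

module CanonicalBase {n : ℕ} {𝒞 : Family n} (cs : IsClosureSystem 𝒞) (𝒞? : Decidable 𝒞)
                     {Shape : Pred (Subset n) 0ℓ} (shape? : Decidable Shape) where
  open ClosureSystemProperties cs 𝒞?

  Admissible : Subset n → Fin n → Set
  Admissible A b = Nonempty A × Shape A × b ∈ φ 𝒞 𝒞? A

  admissible? : ∀ A b → Dec (Admissible A b)
  admissible? A b = nonempty? A ×-dec shape? A ×-dec (b ∈? φ 𝒞 𝒞? A)

  candidates : Subset n → Fin n → ImplicationalBase n
  candidates A b with admissible? A b
  ... | yes (A≢∅ , _) = (A ⇒ b ∣ A≢∅) ∷ []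
  ... | no _          = []

  ∈-candidates⁻ : ∀ A b {i} → i ∈ₗ candidates A b → Admissible (premise i) (conclusion i)
  ∈-candidates⁻ A b i∈ with admissible? A b
  ∈-candidates⁻ A b (here refl) | yes adm = adm

  ∈-candidates⁺ : ∀ {A b} → Admissible A b → ∃ λ A≢∅ → (A ⇒ b ∣ A≢∅) ∈ₗ candidates A b
  ∈-candidates⁺ {A} {b} adm with admissible? A b
  ... | yes (A≢∅ , _) = A≢∅ , here refl
  ... | no ¬adm       = contradiction adm ¬adm

  private
    premiseConclusionPairs : List (Subset n × Fin n)
    premiseConclusionPairs = cartesianProduct (allSubsets n) (allFin n)

  canonical : ImplicationalBase n
  canonical = concatMap (uncurry candidates) premiseConclusionPairs

  ∈-canonical⁻ : ∀ {i} → i ∈ₗ canonical → Admissible (premise i) (conclusion i)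
  ∈-canonical⁻ i∈ with satisfied (∈-concatMap⁻ (uncurry candidates) {xs = premiseConclusionPairs} i∈)
  ... | (A , b) , i∈candidates = ∈-candidates⁻ A b i∈candidates

  ∈-canonical⁺ : ∀ {A b} → Admissible A b → ∃ λ A≢∅ → (A ⇒ b ∣ A≢∅) ∈ₗ canonical
  ∈-canonical⁺ {A} {b} adm with ∈-candidates⁺ adm
  ... | A≢∅ , i∈candidates = A≢∅ , ∈-concatMap⁺ (uncurry candidates)
          (lose (∈-cartesianProduct⁺ (∈-allSubsets A) (∈-allFin b)) i∈candidates)

  closed⇒respects : ∀ {C} → 𝒞 C → Respects canonical C
  closed⇒respects cC i∈ A⊆C = φ-least cC A⊆C (proj₂ (proj₂ (∈-canonical⁻ i∈)))

  -- The empty premise, excluded from the base, is covered by ∅ being closed.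
  respects⇒φ⊆ : 𝒞 ⊥ → ∀ {Y A} → Respects canonical Y → Shape A → A ⊆ Y → φ 𝒞 𝒞? A ⊆ Y
  respects⇒φ⊆ ⊥-closed {A = A} resp shapeA A⊆Y with nonempty? A
  ... | yes A≢∅    = λ b∈φA → resp (proj₂ (∈-canonical⁺ (A≢∅ , shapeA , b∈φA))) A⊆Y
  ... | no A-empty = ⊆-trans (φ-least ⊥-closed (⊆-reflexive (Empty-unique A-empty))) ⊥⊆

module MeetIrreducibles {n : ℕ} (𝒞 : Family n) (𝒞? : Decidable 𝒞) (U₂ : Subset n) where

  ProperMeet : Subset n → Set
  ProperMeet D = ∃₂ λ C C' → 𝒞₂ 𝒞 U₂ C × 𝒞₂ 𝒞 U₂ C' × D ≡ C ∩ C' × D ≢ C × D ≢ C'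

  properMeet? : Decidable ProperMeet
  properMeet? D = anySubset? λ C → anySubset? λ C' →
    (𝒞? C ×-dec C ⊆? U₂) ×-dec (𝒞? C' ×-dec C' ⊆? U₂) ×-dec
    (D ≟ₛ (C ∩ C')) ×-dec ¬? (D ≟ₛ C) ×-dec ¬? (D ≟ₛ C')

  irreducible⊎properMeet : ∀ {D} → 𝒞₂ 𝒞 U₂ D → D ≢ U₂ → MeetIrreducible₂ 𝒞 U₂ D ⊎ ProperMeet D
  irreducible⊎properMeet {D} cD D≢U₂ with properMeet? D
  ... | yes meet = inj₂ meet
  ... | no ¬meet = inj₁ (cD , D≢U₂ , irreducible)
    where
    irreducible : ∀ C C' → 𝒞₂ 𝒞 U₂ C → 𝒞₂ 𝒞 U₂ C' → D ≡ C ∩ C' → D ≡ C ⊎ D ≡ C'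
    irreducible C C' cC cC' D≡C∩C' with D ≟ₛ C | D ≟ₛ C'
    ... | yes D≡C | _       = inj₁ D≡C
    ... | no _    | yes D≡C' = inj₂ D≡C'
    ... | no D≢C  | no D≢C'  = contradiction (C , C' , cC , cC' , D≡C∩C' , D≢C , D≢C') ¬meet

  𝒞₂-induction : (Q : Subset n → Set) → (∀ {C C'} → Q C → Q C' → Q (C ∩ C')) →
    Q U₂ → (∀ {M} → MeetIrreducible₂ 𝒞 U₂ M → Q M) → ∀ {D} → 𝒞₂ 𝒞 U₂ D → Q D
  𝒞₂-induction Q Q-∩ Q-top Q-irreducible {D} = go D (⊃-wellFounded D)
    where
    go : ∀ D → Acc _⊃_ D → 𝒞₂ 𝒞 U₂ D → Q D
    go D (acc below) cD with D ≟ₛ U₂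
    ... | yes refl = Q-top
    ... | no D≢U₂ with irreducible⊎properMeet cD D≢U₂
    ... | inj₁ irreducible = Q-irreducible irreducible
    ... | inj₂ (C , C' , cC , cC' , refl , D≢C , D≢C') =
      Q-∩ (go C (below (⊆∧≢⇒⊂ (p∩q⊆p C C') D≢C)) cC) (go C' (below (⊆∧≢⇒⊂ (p∩q⊆q C C') D≢C')) cC')

module Bipartition {n : ℕ} {U₁ U₂ : Subset n} (U₁∩U₂≡⊥ : U₁ ∩ U₂ ≡ ⊥) (U₁∪U₂≡⊤ : U₁ ∪ U₂ ≡ ⊤) where
  open ≡-Reasoning

  disjoint : ∀ {x} → x ∈ U₁ → x ∉ U₂
  disjoint x∈U₁ x∈U₂ = ∉⊥ (subst (_ ∈_) U₁∩U₂≡⊥ (x∈p∩q⁺ (x∈U₁ , x∈U₂)))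

  ⊆U₁⇒∩U₂≡⊥ : ∀ {P} → P ⊆ U₁ → P ∩ U₂ ≡ ⊥
  ⊆U₁⇒∩U₂≡⊥ {P} P⊆U₁ = Empty-unique λ (x , x∈P∩U₂) →
    disjoint (P⊆U₁ (p∩q⊆p P U₂ x∈P∩U₂)) (p∩q⊆q P U₂ x∈P∩U₂)

  ⊆U₂⇒∩U₁≡⊥ : ∀ {Q} → Q ⊆ U₂ → Q ∩ U₁ ≡ ⊥
  ⊆U₂⇒∩U₁≡⊥ {Q} Q⊆U₂ = Empty-unique λ (x , x∈Q∩U₁) →
    disjoint (p∩q⊆q Q U₁ x∈Q∩U₁) (Q⊆U₂ (p∩q⊆p Q U₁ x∈Q∩U₁))

  ∩-parts : ∀ C → C ≡ (C ∩ U₁) ∪ (C ∩ U₂)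
  ∩-parts C = begin
    C                    ≡⟨ sym (∩-identityʳ C) ⟩
    C ∩ ⊤                ≡⟨ cong (C ∩_) (sym U₁∪U₂≡⊤) ⟩
    C ∩ (U₁ ∪ U₂)        ≡⟨ ∩-distribˡ-∪ C U₁ U₂ ⟩
    (C ∩ U₁) ∪ (C ∩ U₂)  ∎

  ≡-by-parts : ∀ {C D} → C ∩ U₁ ≡ D ∩ U₁ → C ∩ U₂ ≡ D ∩ U₂ → C ≡ D
  ≡-by-parts {C} {D} eq₁ eq₂ = begin
    C                    ≡⟨ ∩-parts C ⟩
    (C ∩ U₁) ∪ (C ∩ U₂)  ≡⟨ cong₂ _∪_ eq₁ eq₂ ⟩
    (D ∩ U₁) ∪ (D ∩ U₂)  ≡⟨ sym (∩-parts D) ⟩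
    D                    ∎

  ∪-∩U₁ : ∀ {P Q} → P ⊆ U₁ → Q ⊆ U₂ → (P ∪ Q) ∩ U₁ ≡ P
  ∪-∩U₁ {P} {Q} P⊆U₁ Q⊆U₂ = begin
    (P ∪ Q) ∩ U₁         ≡⟨ ∩-distribʳ-∪ U₁ P Q ⟩
    (P ∩ U₁) ∪ (Q ∩ U₁)  ≡⟨ cong₂ _∪_ (⊆⇒∩≡ P⊆U₁) (⊆U₂⇒∩U₁≡⊥ Q⊆U₂) ⟩
    P ∪ ⊥                ≡⟨ ∪-identityʳ P ⟩
    P                    ∎

  ∪-∩U₂ : ∀ {P Q} → P ⊆ U₁ → Q ⊆ U₂ → (P ∪ Q) ∩ U₂ ≡ Q
  ∪-∩U₂ {P} {Q} P⊆U₁ Q⊆U₂ = begin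
    (P ∪ Q) ∩ U₂         ≡⟨ ∩-distribʳ-∪ U₂ P Q ⟩
    (P ∩ U₂) ∪ (Q ∩ U₂)  ≡⟨ cong₂ _∪_ (⊆U₁⇒∩U₂≡⊥ P⊆U₁) (⊆⇒∩≡ Q⊆U₂) ⟩
    ⊥ ∪ Q                ≡⟨ ∪-identityˡ Q ⟩
    Q                    ∎

  ⊆∪⇒⊆ˡ : ∀ {A P Q} → A ⊆ U₁ → Q ⊆ U₂ → A ⊆ P ∪ Q → A ⊆ P
  ⊆∪⇒⊆ˡ {A} {P} {Q} A⊆U₁ Q⊆U₂ A⊆P∪Q x∈A with x∈p∪q⁻ P Q (A⊆P∪Q x∈A)
  ... | inj₁ x∈P = x∈P
  ... | inj₂ x∈Q = contradiction (Q⊆U₂ x∈Q) (disjoint (A⊆U₁ x∈A))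

  ⊆∪⇒⊆ʳ : ∀ {A P Q} → A ⊆ U₂ → P ⊆ U₁ → A ⊆ P ∪ Q → A ⊆ Q
  ⊆∪⇒⊆ʳ {A} {P} {Q} A⊆U₂ P⊆U₁ A⊆P∪Q x∈A with x∈p∪q⁻ P Q (A⊆P∪Q x∈A)
  ... | inj₁ x∈P = contradiction (A⊆U₂ x∈A) (disjoint (P⊆U₁ x∈P))
  ... | inj₂ x∈Q = x∈Q

module Extensions {n : ℕ} {𝒞 : Family n} (cs : IsClosureSystem 𝒞) {U₁ U₂ : Subset n}
                  (U₁∩U₂≡⊥ : U₁ ∩ U₂ ≡ ⊥) (U₁∪U₂≡⊤ : U₁ ∪ U₂ ≡ ⊤) where
  open IsClosureSystem cs
  open Bipartition U₁∩U₂≡⊥ U₁∪U₂≡⊤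
  open ≡-Reasoning

  Ext : Subset n → Subset n → Set
  Ext = InExtRestr 𝒞 U₁ U₂

  Ext-∩ : ∀ {C C' X} → Ext C X → Ext C' X → Ext (C ∩ C') X
  Ext-∩ (E , cE , refl , refl) (E' , cE' , refl , E∩U₁≡E'∩U₁) =
    E ∩ E' , ∩-closed cE cE' , ∩-distribʳ-∩ U₂ E E' , (begin
      E ∩ U₁               ≡⟨ sym (∩-idem (E ∩ U₁)) ⟩
      (E ∩ U₁) ∩ (E ∩ U₁)  ≡⟨ cong ((E ∩ U₁) ∩_) E∩U₁≡E'∩U₁ ⟩
      (E ∩ U₁) ∩ (E' ∩ U₁) ≡⟨ sym (∩-distribʳ-∩ U₁ E E') ⟩
      (E ∩ E') ∩ U₁        ∎)

  Ext-parts⇒closed : ∀ {Y} → Ext (Y ∩ U₂) (Y ∩ U₁) → 𝒞 Y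
  Ext-parts⇒closed (C , cC , C∩U₂≡Y∩U₂ , Y∩U₁≡C∩U₁) =
    subst 𝒞 (≡-by-parts (sym Y∩U₁≡C∩U₁) C∩U₂≡Y∩U₂) cC

  -- X ∪ C₂' is closed: a premise inside U₁ sees only X ⊆ C, one inside U₂ sees only C₂'.
  splitBase⇒Ext-mono : ∀ {Σ'} → IsBaseFor Σ' 𝒞 → (∀ {i} → i ∈ₗ Σ' → premise i ⊆ U₁ ⊎ premise i ⊆ U₂) →
    ∀ {C₂ C₂' X} → 𝒞₂ 𝒞 U₂ C₂' → C₂ ⊆ C₂' → Ext C₂ X → Ext C₂' X
  splitBase⇒Ext-mono {Σ'} base split {C₂' = C₂'} (cC₂' , C₂'⊆U₂) C₂⊆C₂' (C , cC , refl , refl) =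
    X ∪ C₂' , proj₂ (base (X ∪ C₂')) respects , ∪-∩U₂ X⊆U₁ C₂'⊆U₂ , sym (∪-∩U₁ X⊆U₁ C₂'⊆U₂)
    where
    X = C ∩ U₁
    X⊆U₁ : X ⊆ U₁
    X⊆U₁ = p∩q⊆q C U₁
    C⊆X∪C₂' : C ⊆ X ∪ C₂'
    C⊆X∪C₂' x∈C with x∈p∪q⁻ X (C ∩ U₂) (subst (_ ∈_) (∩-parts C) x∈C)
    ... | inj₁ x∈X = p⊆p∪q C₂' x∈X
    ... | inj₂ x∈C₂ = q⊆p∪q X C₂' (C₂⊆C₂' x∈C₂)
    respects : Respects Σ' (X ∪ C₂')
    respects i∈ A⊆X∪C₂' with split i∈
    ... | inj₁ A⊆U₁ =
      C⊆X∪C₂' (proj₁ (base C) cC i∈ (⊆-trans (⊆∪⇒⊆ˡ A⊆U₁ C₂'⊆U₂ A⊆X∪C₂') (p∩q⊆p C U₁)))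
    ... | inj₂ A⊆U₂ =
      q⊆p∪q X C₂' (proj₁ (base C₂') cC₂' i∈ (⊆∪⇒⊆ʳ A⊆U₂ X⊆U₁ A⊆X∪C₂'))

module SplitCharacterisation {n : ℕ} {𝒞 : Family n} (𝒞? : Decidable 𝒞) (cs : IsClosureSystem 𝒞)
         (std : IsStandard 𝒞 𝒞?) {U₁ U₂ : Subset n} (U₁∩U₂≡⊥ : U₁ ∩ U₂ ≡ ⊥) (U₁∪U₂≡⊤ : U₁ ∪ U₂ ≡ ⊤)
         (U₂-closed : 𝒞 U₂) where
  open ClosureSystemProperties cs 𝒞?
  open Extensions cs U₁∩U₂≡⊥ U₁∪U₂≡⊤
  open MeetIrreducibles 𝒞 𝒞? U₂

  ExtInclusions : Set
  ExtInclusions = ∀ C₂ → 𝒞₂ 𝒞 U₂ C₂ →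
    ∀ C₂' → (MeetIrreducible₂ 𝒞 U₂ C₂' × C₂ ⊆ C₂') ⊎ C₂' ≡ U₂ →
    ∀ X → Ext C₂ X → Ext C₂' X

  acyclicSplit⇒ExtInclusions : AcyclicSplit 𝒞 U₁ U₂ → ExtInclusions
  acyclicSplit⇒ExtInclusions (_ , base , split , _) _ _ _ (inj₁ ((cC₂' , _) , C₂⊆C₂')) _ =
    splitBase⇒Ext-mono base split cC₂' C₂⊆C₂'
  acyclicSplit⇒ExtInclusions (_ , base , split , _) _ (_ , C₂⊆U₂) _ (inj₂ refl) _ =
    splitBase⇒Ext-mono base split (U₂-closed , ⊆-refl) C₂⊆U₂

  ExtInclusions⇒Ext-mono : ExtInclusions → ∀ {C₂ D X} → 𝒞₂ 𝒞 U₂ C₂ → 𝒞₂ 𝒞 U₂ D → C₂ ⊆ D → Ext C₂ X → Ext D X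
  ExtInclusions⇒Ext-mono inclusions {C₂} {X = X} cC₂ cD C₂⊆D X∈Ext =
    𝒞₂-induction (λ D → C₂ ⊆ D → Ext D X)
      (λ {C} {C'} ext ext' C₂⊆C∩C' →
        Ext-∩ (ext (⊆-trans C₂⊆C∩C' (p∩q⊆p C C'))) (ext' (⊆-trans C₂⊆C∩C' (p∩q⊆q C C'))))
      (λ _ → inclusions C₂ cC₂ U₂ (inj₂ refl) X X∈Ext)
      (λ {M} irreducible C₂⊆M → inclusions C₂ cC₂ M (inj₁ (irreducible , C₂⊆M)) X X∈Ext)
      cD C₂⊆D

  Split : Subset n → Set
  Split A = A ⊆ U₁ ⊎ A ⊆ U₂

  open CanonicalBase cs 𝒞? {Shape = Split} (λ A → (A ⊆? U₁) ⊎-dec (A ⊆? U₂))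
    renaming (canonical to splitBase)

  splitBase-cross : ∀ i → InCross splitBase U₁ U₂ i → premise i ⊆ U₁
  splitBase-cross i (i∈ , _ , ¬inside₂) with ∈-canonical⁻ i∈
  ... | _ , inj₁ A⊆U₁ , _ = A⊆U₁
  ... | _ , inj₂ A⊆U₂ , b∈φA = ⊥-elim (¬inside₂ inside₂)
    where
    inside₂ : InsideOf i U₂
    inside₂ x∈A∪b with x∈p∪q⁻ (premise i) ⁅ conclusion i ⁆ x∈A∪b
    ... | inj₁ x∈A = A⊆U₂ x∈A
    ... | inj₂ x∈b = subst (_∈ U₂) (sym (x∈⁅y⁆⇒x≡y _ x∈b)) (φ-least U₂-closed A⊆U₂ b∈φA)

  respects⇒closed : ExtInclusions → ∀ {Y} → Respects splitBase Y → 𝒞 Y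
  respects⇒closed inclusions {Y} resp =
    Ext-parts⇒closed (ExtInclusions⇒Ext-mono inclusions cF₂ cY₂ F₂⊆Y₂ X∈ExtF₂)
    where
    φ⊆Y : ∀ {A} → Split A → A ⊆ Y → φ 𝒞 𝒞? A ⊆ Y
    φ⊆Y = respects⇒φ⊆ (standard⇒⊥-closed std) resp
    X = Y ∩ U₁
    F = φ 𝒞 𝒞? X
    F⊆Y : F ⊆ Y
    F⊆Y = φ⊆Y (inj₁ (p∩q⊆q Y U₁)) (p∩q⊆p Y U₁)
    cF₂ : 𝒞₂ 𝒞 U₂ (F ∩ U₂)
    cF₂ = IsClosureSystem.∩-closed cs (φ-closed X) U₂-closed , p∩q⊆q F U₂
    cY₂ : 𝒞₂ 𝒞 U₂ (Y ∩ U₂)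
    cY₂ = φ⊆⇒closed (λ x∈φ → x∈p∩q⁺ (φ⊆Y (inj₂ (p∩q⊆q Y U₂)) (p∩q⊆p Y U₂) x∈φ ,
                                    φ-least U₂-closed (p∩q⊆q Y U₂) x∈φ))
        , p∩q⊆q Y U₂
    F₂⊆Y₂ : F ∩ U₂ ⊆ Y ∩ U₂
    F₂⊆Y₂ x∈F₂ = x∈p∩q⁺ (F⊆Y (p∩q⊆p F U₂ x∈F₂) , p∩q⊆q F U₂ x∈F₂)
    X∈ExtF₂ : Ext (F ∩ U₂) X
    X∈ExtF₂ = F , φ-closed X , refl , ⊆-antisym
      (λ x∈X → x∈p∩q⁺ (φ-extensive x∈X , p∩q⊆q Y U₁ x∈X))
      (λ x∈F₁ → x∈p∩q⁺ (F⊆Y (p∩q⊆p F U₁ x∈F₁) , p∩q⊆q F U₁ x∈F₁))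

  ExtInclusions⇒acyclicSplit : ExtInclusions → AcyclicSplit 𝒞 U₁ U₂
  ExtInclusions⇒acyclicSplit inclusions =
    splitBase , (λ C → closed⇒respects , respects⇒closed inclusions) ,
    (λ i∈ → proj₁ (proj₂ (∈-canonical⁻ i∈))) , splitBase-cross

corollary3 : {n : ℕ} (𝒞 : Family n) (𝒞? : Decidable 𝒞) →
    IsClosureSystem 𝒞 → IsStandard 𝒞 𝒞? →
    (U₁ U₂ : Subset n) → Nonempty U₁ → Nonempty U₂ →
    U₁ ∩ U₂ ≡ ⊥ → U₁ ∪ U₂ ≡ ⊤ → 𝒞 U₂ →
    AcyclicSplit 𝒞 U₁ U₂ ⇔
    (∀ C₂ → 𝒞₂ 𝒞 U₂ C₂ →
      ∀ C₂' → (MeetIrreducible₂ 𝒞 U₂ C₂' × C₂ ⊆ C₂') ⊎ C₂' ≡ U₂ →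
      ∀ X → InExtRestr 𝒞 U₁ U₂ C₂ X → InExtRestr 𝒞 U₁ U₂ C₂' X)
corollary3 𝒞 𝒞? cs std U₁ U₂ _ _ U₁∩U₂≡⊥ U₁∪U₂≡⊤ U₂-closed =
  mk⇔ acyclicSplit⇒ExtInclusions ExtInclusions⇒acyclicSplit
  where open SplitCharacterisation 𝒞? cs std U₁∩U₂≡⊥ U₁∪U₂≡⊤ U₂-closed
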